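{- Let $G=(V,E)$ be a finite connected graph. Then $G$ admits a retraction onto a sober connected restriction $G'=(V',E')$ such that $\mathrm{Fl}\,G\cong\mathrm{Fl}\,G'$.
   Context: Graphs are finite, undirected, without loops or multiple edges. $\mathrm{St}(v)$ is the set of neighbours of $v$; $\mathrm{St}(W)=\bigcap_{w\in W}\mathrm{St}(w)$ with $\mathrm{St}(\emptyset)$ the whole vertex set; $\mathrm{Fl}\,G=\{\mathrm{St}(W)\mid W\subseteq V\}$ ordered by inclusion. $G$ is sober if $v\mapsto\mathrm{St}(v)$ is injective. A restriction of $G$ is an induced subgraph $(V',E\cap 2^{V'})$ with $V'\subseteq V$. A morphism $G\to G'$ is a map on vertices sending edges to edges; it is a retraction if $G'$ is a restriction of $G$ and the map is the identity on $V'$. -}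

module Defs where

open import Data.Nat using (ℕ)
open import Data.Fin using (Fin; zero; suc)
open import Data.Bool using (Bool; true; false; T; not; _∧_; _∨_)
open import Data.Vec using (tabulate; lookup)
open import Data.Fin.Subset using (Subset; _⊆_; ⁅_⁆)
open import Data.Product using (Σ; ∃; _×_; _,_; proj₁)
open import Relation.Binary.PropositionalEquality using (_≡_)
open import Relation.Binary.Construct.Closure.ReflexiveTransitive using (Star)
open import Relation.Nullary using (¬_)

record Graph : Set where
  field
    n       : ℕ
    adj     : Fin n → Fin n → Bool
    adj-sym : ∀ u v → adj u v ≡ adj v u
    adj-irr : ∀ v → adj v v ≡ false
open Graph public

Vtx : Graph → Set
Vtx G = Fin (n G)

Adj : (G : Graph) → Vtx G → Vtx G → Set
Adj G u v = T (adj G u v)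

allFin : ∀ {k} → (Fin k → Bool) → Bool
allFin {ℕ.zero}  f = true
allFin {ℕ.suc k} f = f zero ∧ allFin (λ i → f (suc i))

-- St(W) = ⋂_{w ∈ W} St(w); St(∅) = V
St : (G : Graph) → Subset (n G) → Subset (n G)
St G W = tabulate (λ v → allFin (λ w → not (lookup W w) ∨ adj G w v))

Stv : (G : Graph) → Vtx G → Subset (n G)
Stv G v = St G ⁅ v ⁆

Fl : Graph → Set
Fl G = Σ (Subset (n G)) (λ S → ∃ (λ W → St G W ≡ S))

record FlIso (G G' : Graph) : Set where
  field
    to      : Fl G → Fl G'
    from    : Fl G' → Fl G
    from-to : ∀ x → proj₁ (from (to x)) ≡ proj₁ x
    to-from : ∀ y → proj₁ (to (from y)) ≡ proj₁ y
    mono    : ∀ x y → proj₁ x ⊆ proj₁ y → proj₁ (to x) ⊆ proj₁ (to y)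
    reflect : ∀ x y → proj₁ (to x) ⊆ proj₁ (to y) → proj₁ x ⊆ proj₁ y

Sober : Graph → Set
Sober G = ∀ u v → Stv G u ≡ Stv G v → u ≡ v

Connected : Graph → Set
Connected G = ∀ u v → Star (Adj G) u v

IsMorphism : (G G' : Graph) → (Vtx G → Vtx G') → Set
IsMorphism G G' f = ∀ u v → Adj G u v → Adj G' (f u) (f v)

-- restriction of G to the vertices listed by e : Fin m → Fin n
-- (the induced subgraph on the image of e; e will be injective)
restrict : (G : Graph) {m : ℕ} → (Fin m → Vtx G) → Graph
restrict G {m} e = record
  { n = m
  ; adj = λ i j → adj G (e i) (e j)
  ; adj-sym = λ i j → adj-sym G (e i) (e j)
  ; adj-irr = λ i → adj-irr G (e i) }

IsRetraction : (G : Graph) {m : ℕ} (e : Fin m → Vtx G) → (Vtx G → Fin m) → Set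
IsRetraction G e r = IsMorphism G (restrict G e) r × (∀ i → r (e i) ≡ i)

module Submission where

-- Call two vertices twins when they have the same
-- neighbourhood St(v).  Choose one representative in every twin class and
-- let G' be the restriction of G to the representatives; r sends a vertex to
-- (the index of) its representative and e lists the representatives.

open import Defs
open import Data.Nat using (ℕ; zero; suc)
open import Data.Fin using (Fin; zero; suc)
import Data.Fin as Fin
open import Data.Fin.Properties using (any?)
open import Data.Fin.Subset using (Subset; _⊆_; _∈_; ⁅_⁆)
open import Data.Fin.Subset.Properties using (⊆-antisym; x∈⁅x⁆; x∈⁅y⁆⇒x≡y)
open import Data.Bool using (Bool; true; false; T; not; _∨_)
import Data.Bool as Bool
open import Data.Bool.Properties using (T-≡; T-∧)
open import Data.Vec using (tabulate; lookup)
open import Data.Vec.Properties using (lookup∘tabulate; []=⇒lookup; lookup⇒[]=; ≡-dec)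
open import Data.Product using (Σ; ∃; _×_; _,_; proj₁)
open import Data.Unit using (tt)
open import Function using (_∘_; _⇔_; mk⇔; Equivalence)
open import Relation.Binary.Definitions using (DecidableEquality)
open import Relation.Binary.PropositionalEquality
open import Relation.Binary.Construct.Closure.ReflexiveTransitive using (Star; gmap)
open import Relation.Nullary using (yes; no; ¬_; contradiction)
open import Relation.Unary using (Decidable)

open Equivalence using () renaming (to to ⇒; from to ⇐)

∈⇔T : ∀ {k} {S : Subset k} {x : Fin k} → x ∈ S ⇔ T (lookup S x)
∈⇔T {S = S} {x} = mk⇔ (⇐ T-≡ ∘ []=⇒lookup) (lookup⇒[]= x S ∘ ⇒ T-≡)

∈-tabulate : ∀ {k} (f : Fin k → Bool) {x : Fin k} → x ∈ tabulate f ⇔ T (f x)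
∈-tabulate f {x} = mk⇔ (subst T (lookup∘tabulate f x) ∘ ⇒ ∈⇔T)
                       (⇐ ∈⇔T ∘ subst T (sym (lookup∘tabulate f x)))

preimage : ∀ {k l} → (Fin l → Fin k) → Subset k → Subset l
preimage g S = tabulate (λ x → lookup S (g x))

∈-preimage : ∀ {k l} (g : Fin l → Fin k) (S : Subset k) {x : Fin l} →
             x ∈ preimage g S ⇔ g x ∈ S
∈-preimage g S = mk⇔ (⇐ ∈⇔T ∘ ⇒ (∈-tabulate _)) (⇐ (∈-tabulate _) ∘ ⇒ ∈⇔T)

preimage-mono : ∀ {k l} (g : Fin l → Fin k) {S S′ : Subset k} →
                S ⊆ S′ → preimage g S ⊆ preimage g S′
preimage-mono g {S} {S′} S⊆S′ =
  ⇐ (∈-preimage g S′) ∘ S⊆S′ ∘ ⇒ (∈-preimage g S)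

preimage-preimage : ∀ {k l} (g : Fin l → Fin k) (h : Fin k → Fin l) (S : Subset k) →
                    (∀ x → x ∈ S ⇔ g (h x) ∈ S) → preimage h (preimage g S) ≡ S
preimage-preimage g h S invariant = ⊆-antisym
  (λ {x} → ⇐ (invariant x) ∘ ⇒ (∈-preimage g S) ∘ ⇒ (∈-preimage h (preimage g S)))
  (λ {x} → ⇐ (∈-preimage h (preimage g S)) ∘ ⇐ (∈-preimage g S) ∘ ⇒ (invariant x))

T-allFin : ∀ {k} (f : Fin k → Bool) → T (allFin f) ⇔ (∀ i → T (f i))
T-allFin {zero}  f = mk⇔ (λ _ ()) (λ _ → tt)
T-allFin {suc k} f = mk⇔
  (λ t → let (t₀ , tₛ) = ⇒ T-∧ t in λ { zero → t₀ ; (suc i) → ⇒ (T-allFin (f ∘ suc)) tₛ i })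
  (λ h → ⇐ T-∧ (h zero , ⇐ (T-allFin (f ∘ suc)) (h ∘ suc)))

T-implication : ∀ {a b} → T (not a ∨ b) ⇔ (T a → T b)
T-implication {false} = mk⇔ (λ _ ()) (λ _ → tt)
T-implication {true}  = mk⇔ (λ t _ → t) (λ h → h tt)

Adj-sym : (G : Graph) {u v : Vtx G} → Adj G u v → Adj G v u
Adj-sym G {u} {v} = subst T (adj-sym G u v)

∈-St : (G : Graph) (W : Subset (n G)) {x : Vtx G} →
       x ∈ St G W ⇔ (∀ w → w ∈ W → Adj G w x)
∈-St G W = mk⇔
  (λ x∈ w w∈W → ⇒ T-implication (⇒ (T-allFin _) (⇒ (∈-tabulate _) x∈) w) (⇒ ∈⇔T w∈W))
  (λ h → ⇐ (∈-tabulate _) (⇐ (T-allFin _) (λ w → ⇐ T-implication (h w ∘ ⇐ ∈⇔T))))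

∈-Stv : (G : Graph) (v : Vtx G) {x : Vtx G} → x ∈ Stv G v ⇔ Adj G v x
∈-Stv G v = mk⇔
  (λ x∈ → ⇒ (∈-St G ⁅ v ⁆) x∈ v (x∈⁅x⁆ v))
  (λ a → ⇐ (∈-St G ⁅ v ⁆) (λ w w∈ → subst (λ u → Adj G u _) (sym (x∈⁅y⁆⇒x≡y v w∈)) a))

-- St is antitone and St ∘ St is extensive: a Galois connection, whence
-- St ∘ St ∘ St = St.  This makes the flats exactly the St-images of flats.
St-antitone : (G : Graph) {W W′ : Subset (n G)} → W ⊆ W′ → St G W′ ⊆ St G W
St-antitone G {W} {W′} W⊆W′ x∈ =
  ⇐ (∈-St G W) (λ w → ⇒ (∈-St G W′) x∈ w ∘ W⊆W′)

⊆-St-St : (G : Graph) (W : Subset (n G)) → W ⊆ St G (St G W)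
⊆-St-St G W w∈W =
  ⇐ (∈-St G (St G W)) (λ x x∈ → Adj-sym G (⇒ (∈-St G W) x∈ _ w∈W))

St-St-St : (G : Graph) (W : Subset (n G)) → St G (St G (St G W)) ≡ St G W
St-St-St G W = ⊆-antisym (St-antitone G (⊆-St-St G W)) (⊆-St-St G (St G W))

record Enumeration {k : ℕ} (P : Fin k → Set) : Set where
  field
    size       : ℕ
    elem       : Fin size → Fin k
    elem-P     : ∀ i → P (elem i)
    index      : ∀ v → P v → Fin size
    elem-index : ∀ v p → elem (index v p) ≡ v
    index-elem : ∀ i p → index (elem i) p ≡ i

module _ {k : ℕ} {P : Fin (suc k) → Set} (E : Enumeration (P ∘ suc)) where
  open Enumeration E

  enumeration-with-zero : P zero → Enumeration P
  enumeration-with-zero P₀ = record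
    { size = suc size ; elem = elem′ ; elem-P = elem-P′ ; index = index′
    ; elem-index = elem-index′ ; index-elem = index-elem′ }
    where
    elem′ : Fin (suc size) → Fin (suc k)
    elem′ zero    = zero
    elem′ (suc i) = suc (elem i)
    elem-P′ : ∀ i → P (elem′ i)
    elem-P′ zero    = P₀
    elem-P′ (suc i) = elem-P i
    index′ : ∀ v → P v → Fin (suc size)
    index′ zero    _ = zero
    index′ (suc v) p = suc (index v p)
    elem-index′ : ∀ v p → elem′ (index′ v p) ≡ v
    elem-index′ zero    _ = refl
    elem-index′ (suc v) p = cong suc (elem-index v p)
    index-elem′ : ∀ i p → index′ (elem′ i) p ≡ i
    index-elem′ zero    _ = refl
    index-elem′ (suc i) p = cong suc (index-elem i p)

  enumeration-without-zero : ¬ P zero → Enumeration P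
  enumeration-without-zero ¬P₀ = record
    { size = size ; elem = suc ∘ elem ; elem-P = elem-P ; index = index′
    ; elem-index = elem-index′ ; index-elem = index-elem }
    where
    index′ : ∀ v → P v → Fin size
    index′ zero    p = contradiction p ¬P₀
    index′ (suc v) p = index v p
    elem-index′ : ∀ v p → suc (elem (index′ v p)) ≡ v
    elem-index′ zero    p = contradiction p ¬P₀
    elem-index′ (suc v) p = cong suc (elem-index v p)

enumerate : ∀ {k} {P : Fin k → Set} → Decidable P → Enumeration P
enumerate {zero}  _  = record
  { size = 0 ; elem = λ () ; elem-P = λ () ; index = λ ()
  ; elem-index = λ () ; index-elem = λ () }
enumerate {suc k} P? with P? zero
... | yes P₀ = enumeration-with-zero (enumerate (P? ∘ suc)) P₀
... | no ¬P₀ = enumeration-without-zero (enumerate (P? ∘ suc)) ¬P₀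

record Splitting {N : ℕ} (ρ : Fin N → Fin N) : Set where
  field
    m   : ℕ
    e   : Fin m → Fin N
    r   : Fin N → Fin m
    r∘e : ∀ i → r (e i) ≡ i
    e∘r : ∀ v → e (r v) ≡ ρ v

split-idempotent : ∀ {N} (ρ : Fin N → Fin N) → (∀ v → ρ (ρ v) ≡ ρ v) → Splitting ρ
split-idempotent ρ idem = record
  { m = size ; e = elem ; r = r ; r∘e = r∘e ; e∘r = λ v → elem-index (ρ v) (idem v) }
  where
  open Enumeration (enumerate (λ v → ρ v Fin.≟ v))
  r : _ → Fin size
  r v = index (ρ v) (idem v)
  index-unique : ∀ {v} p {i} → elem i ≡ v → index v p ≡ i
  index-unique p {i} refl = index-elem i p
  r∘e : ∀ i → r (elem i) ≡ i
  r∘e i = index-unique (idem (elem i)) (sym (elem-P i))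

module Representatives {N : ℕ} {B : Set} (_≟_ : DecidableEquality B) (f : Fin N → B) where

  -- some point of the fibre over b, or d when that fibre is empty
  pick : B → Fin N → Fin N
  pick b d with any? (λ u → f u ≟ b)
  ... | yes (u , _) = u
  ... | no  _       = d

  pick-in-fibre : ∀ b d → ∃ (λ u → f u ≡ b) → f (pick b d) ≡ b
  pick-in-fibre b d inhabited with any? (λ u → f u ≟ b)
  ... | yes (_ , fu≡b) = fu≡b
  ... | no  empty      = contradiction inhabited empty

  pick-default-irrelevant : ∀ b d d′ → ∃ (λ u → f u ≡ b) → pick b d ≡ pick b d′
  pick-default-irrelevant b d d′ inhabited with any? (λ u → f u ≟ b)
  ... | yes _     = refl
  ... | no  empty = contradiction inhabited empty

  rep : Fin N → Fin N
  rep v = pick (f v) v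

  f-rep : ∀ v → f (rep v) ≡ f v
  f-rep v = pick-in-fibre (f v) v (v , refl)

  rep-cong : ∀ u v → f u ≡ f v → rep u ≡ rep v
  rep-cong u v fu≡fv = trans (cong (λ b → pick b u) fu≡fv)
                             (pick-default-irrelevant (f v) u v (v , refl))

  rep-idem : ∀ v → rep (rep v) ≡ rep v
  rep-idem v = rep-cong (rep v) v (f-rep v)

record Transversal {N : ℕ} {B : Set} (f : Fin N → B) : Set where
  field
    m           : ℕ
    e           : Fin m → Fin N
    r           : Fin N → Fin m
    r∘e         : ∀ i → r (e i) ≡ i
    f∘e∘r       : ∀ v → f (e (r v)) ≡ f v
    e-separates : ∀ i j → f (e i) ≡ f (e j) → i ≡ j

transversal : ∀ {N} {B : Set} → DecidableEquality B → (f : Fin N → B) → Transversal f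
transversal _≟_ f = record
  { m = m ; e = e ; r = r ; r∘e = r∘e ; f∘e∘r = f∘e∘r ; e-separates = e-separates }
  where
  open Representatives _≟_ f
  open Splitting (split-idempotent rep rep-idem)
  f∘e∘r : ∀ v → f (e (r v)) ≡ f v
  f∘e∘r v = trans (cong f (e∘r v)) (f-rep v)
  rep-fixes-e : ∀ i → rep (e i) ≡ e i
  rep-fixes-e i = trans (sym (e∘r (e i))) (cong e (r∘e i))
  e-separates : ∀ i j → f (e i) ≡ f (e j) → i ≡ j
  e-separates i j fei≡fej = begin
    i               ≡⟨ sym (r∘e i) ⟩
    r (e i)         ≡⟨ cong r (sym (rep-fixes-e i)) ⟩
    r (rep (e i))   ≡⟨ cong r (rep-cong (e i) (e j) fei≡fej) ⟩
    r (rep (e j))   ≡⟨ cong r (rep-fixes-e j) ⟩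
    r (e j)         ≡⟨ r∘e j ⟩
    j               ∎
    where open ≡-Reasoning

module TwinRetraction (G : Graph) {m : ℕ} (e : Fin m → Vtx G) (r : Vtx G → Fin m)
                      (r∘e : ∀ i → r (e i) ≡ i)
                      (twin : ∀ v → Stv G (e (r v)) ≡ Stv G v) where

  G′ : Graph
  G′ = restrict G e

  twinˡ : ∀ u {x} → Adj G (e (r u)) x ⇔ Adj G u x
  twinˡ u {x} = mk⇔
    (⇒ (∈-Stv G u) ∘ subst (x ∈_) (twin u) ∘ ⇐ (∈-Stv G (e (r u))))
    (⇒ (∈-Stv G (e (r u))) ∘ subst (x ∈_) (sym (twin u)) ∘ ⇐ (∈-Stv G u))

  twinʳ : ∀ u {x} → Adj G x (e (r u)) ⇔ Adj G x u
  twinʳ u = mk⇔ (Adj-sym G ∘ ⇒ (twinˡ u) ∘ Adj-sym G) (Adj-sym G ∘ ⇐ (twinˡ u) ∘ Adj-sym G)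

  retraction : IsRetraction G e r
  retraction = (λ u v → ⇐ (twinˡ u) ∘ ⇐ (twinʳ v)) , r∘e

  connected : Connected G → Connected G′
  connected conn i j = subst₂ (Star (Adj G′)) (r∘e i) (r∘e j)
    (gmap r (λ {u} {v} → proj₁ retraction u v) (conn (e i) (e j)))

  sober : (∀ i j → Stv G (e i) ≡ Stv G (e j) → i ≡ j) → Sober G′
  sober separated i j Stv′i≡Stv′j = separated i j
    (⊆-antisym (transfer i j Stv′i≡Stv′j) (transfer j i (sym Stv′i≡Stv′j)))
    where
    -- St(e i) is determined by St′(i), since every vertex x is a twin of e (r x)
    transfer : ∀ a b → Stv G′ a ≡ Stv G′ b → Stv G (e a) ⊆ Stv G (e b)
    transfer a b eq {x} =
      ⇐ (∈-Stv G (e b)) ∘ ⇒ (twinʳ x) ∘ ⇒ (∈-Stv G′ b) ∘ subst (r x ∈_) eq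
      ∘ ⇐ (∈-Stv G′ a) ∘ ⇐ (twinʳ x) ∘ ⇒ (∈-Stv G (e a))

  Saturated : Subset (n G) → Set
  Saturated S = ∀ x → x ∈ S ⇔ e (r x) ∈ S

  St-saturated : ∀ W → Saturated (St G W)
  St-saturated W x = mk⇔
    (λ x∈ → ⇐ (∈-St G W) (λ w → ⇐ (twinʳ x) ∘ ⇒ (∈-St G W) x∈ w))
    (λ x∈ → ⇐ (∈-St G W) (λ w → ⇒ (twinʳ x) ∘ ⇒ (∈-St G W) x∈ w))

  St-preimage-e : ∀ S → Saturated S → preimage e (St G S) ≡ St G′ (preimage e S)
  St-preimage-e S sat = ⊆-antisym
    (λ {k} k∈ → ⇐ (∈-St G′ (preimage e S)) λ j j∈ →
       ⇒ (∈-St G S) (⇒ (∈-preimage e (St G S)) k∈) (e j) (⇒ (∈-preimage e S) j∈))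
    (λ {k} k∈ → ⇐ (∈-preimage e (St G S)) (⇐ (∈-St G S) λ w w∈ →
       ⇒ (twinˡ w) (⇒ (∈-St G′ (preimage e S)) k∈ (r w)
                      (⇐ (∈-preimage e S) (⇒ (sat w) w∈)))))

  St-preimage-r : ∀ W′ → St G (preimage r W′) ≡ preimage r (St G′ W′)
  St-preimage-r W′ = ⊆-antisym
    (λ {x} x∈ → ⇐ (∈-preimage r (St G′ W′)) (⇐ (∈-St G′ W′) λ j j∈ →
       ⇐ (twinʳ x) (⇒ (∈-St G (preimage r W′)) x∈ (e j)
                      (⇐ (∈-preimage r W′) (subst (_∈ W′) (sym (r∘e j)) j∈)))))
    (λ {x} x∈ → ⇐ (∈-St G (preimage r W′)) λ v v∈ →
       ⇒ (twinʳ x) (⇒ (twinˡ v) (⇒ (∈-St G′ W′) (⇒ (∈-preimage r (St G′ W′)) x∈) (r v)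
                                   (⇒ (∈-preimage r W′) v∈))))

  preimage-e-reflects : ∀ S S′ → Saturated S → Saturated S′ →
                        preimage e S ⊆ preimage e S′ → S ⊆ S′
  preimage-e-reflects S S′ sat sat′ incl {x} =
    ⇐ (sat′ x) ∘ ⇒ (∈-preimage e S′) ∘ incl ∘ ⇐ (∈-preimage e S) ∘ ⇒ (sat x)

  flat-iso : FlIso G G′
  flat-iso = record
    { to      = to
    ; from    = from
    ; from-to = λ { (_ , W , refl) → preimage-preimage e r (St G W) (St-saturated W) }
    ; to-from = λ { (S′ , _) → preimage-preimage r e S′
                                 (λ i → mk⇔ (subst (_∈ S′) (sym (r∘e i))) (subst (_∈ S′) (r∘e i))) }
    ; mono    = λ _ _ → preimage-mono e
    ; reflect = λ { (_ , W , refl) (_ , W′ , refl) →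
                    preimage-e-reflects (St G W) (St G W′) (St-saturated W) (St-saturated W′) }
    }
    where
    to : Fl G → Fl G′
    to (S , W , St-W≡S) = preimage e S , preimage e (St G S) ,
      subst (λ S → St G′ (preimage e (St G S)) ≡ preimage e S) St-W≡S (begin
        St G′ (preimage e (St G (St G W)))  ≡⟨ sym (St-preimage-e _ (St-saturated (St G W))) ⟩
        preimage e (St G (St G (St G W)))   ≡⟨ cong (preimage e) (St-St-St G W) ⟩
        preimage e (St G W)                 ∎)
      where open ≡-Reasoning
    from : Fl G′ → Fl G
    from (S′ , W′ , St-W′≡S′) = preimage r S′ , preimage r W′ ,
      trans (St-preimage-r W′) (cong (preimage r) St-W′≡S′)

proposition3p8 : (G : Graph) → Connected G →
    Σ ℕ (λ m → Σ (Fin m → Vtx G) (λ e → Σ (Vtx G → Fin m) (λ r →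
    IsRetraction G e r × Sober (restrict G e) × Connected (restrict G e)
    × FlIso G (restrict G e))))
proposition3p8 G conn =
  m , e , r , retraction , sober e-separates , connected conn , flat-iso
  where
  open Transversal (transversal (≡-dec Bool._≟_) (Stv G))
  open TwinRetraction G e r r∘e f∘e∘r
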